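{- Let $G$ be a graph on the vertex set $[n]$ and $U$ a proper subset of $[n]$. Then there exists a cut set $T$ of $G$ with $T \subset U$ such that $c_G(T) \geq c_G(U)$ and the following properties hold: (i) if $W$ is part of a transversal of $G - U$, then it is also part of a transversal of $G - T$; (ii) if $u \in U \setminus T$, then $u$ does not reconnect any components of $G - U$; (iii) if $U$ is contained in a cut set of $G$, then $c_G(T) = c_G(U)$. Moreover, (iv) if $u_1, \dots, u_a \in U$ and $u_i$ does not reconnect any connected components in $G - (U \setminus \{u_1, \dots, u_{i-1}\})$ for every $i=1,\dots,a$, then the cut set $T \subset U$ above (satisfying $c_G(T)\ge c_G(U)$ and properties (i)–(iii)) can be chosen so that in addition $u_1,\dots,u_a \notin T$.
   Context: $G$ is a finite simple graph on the vertex set $[n]$. For $S \subset [n]$, $c_G(S)$ denotes the number of connected components of $G - S$. A set $S \subset [n]$ is a cut set of $G$ if $S=\emptyset$ or $c_G(S) > c_G(S \setminus \{i\})$ for every $i \in S$. A transversal of $G - S$ is a subset $W$ of the vertices of $G-S$ meeting each connected component of $G-S$ in exactly one vertex. Given $S \subset [n]$, a vertex $v \in S$ reconnects connected components $G_1,\dots,G_r$ ($r\ge 2$) of $G-S$ if, after adding back $v$ to $G-S$ together with all edges of $G$ incident to $v$, the graphs $G_1,\dots,G_r$ lie in the same connected component. -}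

module Defs where

open import Data.Nat using (ℕ; _≤_; _<_)
open import Data.Fin using (Fin)
open import Data.Bool using (Bool; true; false)
open import Data.Fin.Subset using (Subset; _∈_; _∉_; _⊆_; _-_; ⊥)
open import Data.List using (List; []; _∷_)
open import Data.Product using (Σ; ∃; _×_; ∃-syntax)
open import Data.Sum using (_⊎_)
open import Data.Unit using (⊤)
open import Relation.Nullary using (¬_)
open import Relation.Binary.PropositionalEquality using (_≡_)

record Graph (n : ℕ) : Set where
  field
    adj    : Fin n → Fin n → Bool
    sym    : ∀ i j → adj i j ≡ adj j i
    irrefl : ∀ i → adj i i ≡ false
open Graph public

module _ {n : ℕ} (G : Graph n) where

  data Conn (S : Subset n) : Fin n → Fin n → Set where
    here : ∀ {x} → x ∉ S → Conn S x x
    step : ∀ {x y z} → x ∉ S → adj G x y ≡ true → Conn S y z → Conn S x z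

  Transversal : Subset n → Subset n → Set
  Transversal S W =
    (∀ {w} → w ∈ W → w ∉ S) ×
    (∀ v → v ∉ S →
       (∃[ w ] (w ∈ W × Conn S v w)) ×
       (∀ w w′ → w ∈ W → w′ ∈ W → Conn S v w → Conn S v w′ → w ≡ w′))

  PartOfTransversal : Subset n → Subset n → Set
  PartOfTransversal S W = ∃[ W′ ] (Transversal S W′ × W ⊆ W′)

  -- c_G(S) = k : G - S has exactly k connected components, i.e. there is
  -- a family of k vertices of G - S, one in each connected component
  -- (pairwise in distinct components, every vertex of G - S in the
  -- component of one of them).
  NumComponents : Subset n → ℕ → Set
  NumComponents S k =
    Σ (Fin k → Fin n) λ r →
      (∀ i → r i ∉ S) ×
      (∀ i j → Conn S (r i) (r j) → i ≡ j) ×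
      (∀ v → v ∉ S → ∃[ i ] Conn S v (r i))

  _≤c_ : Subset n → Subset n → Set
  S ≤c S′ = ∀ k k′ → NumComponents S k → NumComponents S′ k′ → k ≤ k′

  _<c_ : Subset n → Subset n → Set
  S <c S′ = ∀ k k′ → NumComponents S k → NumComponents S′ k′ → k < k′

  _≡c_ : Subset n → Subset n → Set
  S ≡c S′ = ∀ k k′ → NumComponents S k → NumComponents S′ k′ → k ≡ k′

  CutSet : Subset n → Set
  CutSet S = S ≡ ⊥ ⊎ (∀ i → i ∈ S → (S - i) <c S)

  -- v ∈ S reconnects the components G_1, …, G_r (r ≥ 2) of G - S,
  -- the components being given by vertices x_1, …, x_r of G - S lying in
  -- pairwise distinct components of G - S: after adding v back
  -- (i.e. in G - (S ∖ {v})) they all lie in the same component.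
  Reconnects : Subset n → Fin n → (r : ℕ) → (Fin r → Fin n) → Set
  Reconnects S v r x =
    v ∈ S × 2 ≤ r ×
    (∀ i → x i ∉ S) ×
    (∀ i j → Conn S (x i) (x j) → i ≡ j) ×
    (∀ i j → Conn (S - v) (x i) (x j))

  ReconnectsSome : Subset n → Fin n → Set
  ReconnectsSome S v = ∃[ r ] Σ (Fin r → Fin n) λ x → Reconnects S v r x

  -- Hypothesis of (iv) for the list u₁, …, uₐ:  every uᵢ ∈ U and uᵢ does
  -- not reconnect any components of G - (U ∖ {u₁, …, u_{i-1}}).
  Admissible : Subset n → Subset n → List (Fin n) → Set
  Admissible U S []       = ⊤
  Admissible U S (u ∷ us) = u ∈ U × ¬ ReconnectsSome S u × Admissible U (S - u) us

  GoodCutSet : Subset n → Subset n → Set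
  GoodCutSet U T =
    CutSet T × T ⊆ U × U ≤c T ×
    (∀ W → PartOfTransversal U W → PartOfTransversal T W) ×
    (∀ u → u ∈ U → u ∉ T → ¬ ReconnectsSome U u) ×
    ((∃[ S ] (CutSet S × U ⊆ S)) → T ≡c U)

{-# OPTIONS --safe #-}
-- Starting from U, delete one at a time vertices that reconnect no components of the
-- current graph, until every remaining vertex reconnects some; the result T is then a
-- cut set. Deleting a vertex that reconnects nothing never merges two components of the
-- previous graph, so the components of G - U stay apart in G - T, which gives c(T) ≥ c(U)
-- and (i) (a transversal only has to be extended by the deleted vertex, if it forms a
-- new component); and a vertex reconnecting components of G - U would still reconnect
-- them when it is deleted, which gives (ii). For (iii), every vertex of a cut set S has a
-- neighbour outside S, so for U ⊆ S every component of G - T meets G - U and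
-- c(T) ≤ c(U). For (iv), delete u₁, …, uₐ first.
module Submission where

open import Defs
open import Data.Nat using (ℕ)
open import Data.Fin using (Fin)
open import Data.Fin.Subset using (Subset; _⊂_; _∉_; ⊤)
open import Data.List using (List)
open import Data.List.Relation.Unary.All using (All)
open import Data.Product using (_×_; ∃-syntax)

open import Data.Nat using (zero; suc; _≤_; s≤s; z≤n)
open import Data.Nat.Properties using (<-asym; ≤-antisym)
open import Data.Fin using (zero; suc; _≟_)
open import Data.Fin.Properties using (any?; injective⇒≤)
open import Data.Fin.Subset using (_∈_; _⊆_; _⊃_; _-_; _─_; _∪_; ⁅_⁆; inside; outside)
open import Data.Fin.Subset.Properties
  using (_∈?_; x∈⁅x⁆; x∈⁅y⁆⇒x≡y; x∈p∪q⁺; x∈p∪q⁻; p⊆p∪q; p─q⊆p; x∈p∧x≢y⇒x∈p-y; x∈p⇒p-x⊂p; ∉⊥)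
open import Data.Fin.Subset.Induction using (⊂-wellFounded; ⊃-wellFounded)
open import Data.Vec using (_∷_; here; there)
open import Data.Bool using (true) renaming (_≟_ to _≟ᵇ_)
open import Data.Product using (Σ; _,_; proj₁; proj₂)
open import Data.Sum using (_⊎_; inj₁; inj₂)
open import Data.Empty using (⊥-elim)
open import Function using (_∘_)
open import Data.List using ([]; _∷_; allFin)
open import Data.List.Relation.Unary.Any using (here; there)
open import Data.List.Membership.Propositional using () renaming (_∈_ to _∈ₗ_)
open import Data.List.Membership.Propositional.Properties using (∈-allFin)
import Data.Vec.Functional as VF
open import Data.List.Relation.Unary.All using ([]; _∷_) renaming (map to All-map)
open import Induction.WellFounded using (Acc; acc)
open import Relation.Nullary using (¬_; Dec; yes; no; contradiction)
open import Relation.Nullary.Decidable using (_×-dec_; ¬?; map′; decidable-stable)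
open import Relation.Binary.PropositionalEquality using (_≡_; _≢_; refl; cong; subst)
import Relation.Binary.PropositionalEquality as ≡

private variable
  n : ℕ
  p q : Subset n
  x y : Fin n

x∈p─q⇒x∉q : ∀ (p q : Subset n) → x ∈ p ─ q → x ∉ q
x∈p─q⇒x∉q (inside ∷ p) (outside ∷ q) here      ()
x∈p─q⇒x∉q (_      ∷ p) (_       ∷ q) (there m) (there k) = x∈p─q⇒x∉q p q m k

x∉p-x : x ∉ p - x
x∉p-x {x = x} {p} m = x∈p─q⇒x∉q p ⁅ x ⁆ m (x∈⁅x⁆ x)

p-x⊆p : p - x ⊆ p
p-x⊆p {p = p} {x} = p─q⊆p p ⁅ x ⁆

x∉p-y⇒x∉p⊎x≡y : x ∉ p - y → x ∉ p ⊎ x ≡ y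
x∉p-y⇒x∉p⊎x≡y {x = x} {y = y} x∉p-y with x ≟ y
... | yes x≡y = inj₂ x≡y
... | no  x≢y = inj₁ (λ x∈p → x∉p-y (x∈p∧x≢y⇒x∈p-y x∈p x≢y))

x∈p∪⁅y⁆⇒x∈p⊎x≡y : x ∈ p ∪ ⁅ y ⁆ → x ∈ p ⊎ x ≡ y
x∈p∪⁅y⁆⇒x∈p⊎x≡y {p = p} {y = y} x∈p∪⁅y⁆ with x∈p∪q⁻ p ⁅ y ⁆ x∈p∪⁅y⁆
... | inj₁ x∈p   = inj₁ x∈p
... | inj₂ x∈⁅y⁆ = inj₂ (x∈⁅y⁆⇒x≡y y x∈⁅y⁆)

x∉p∧x≢y⇒x∉p∪⁅y⁆ : x ∉ p → x ≢ y → x ∉ p ∪ ⁅ y ⁆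
x∉p∧x≢y⇒x∉p∪⁅y⁆ x∉p x≢y x∈p∪⁅y⁆ with x∈p∪⁅y⁆⇒x∈p⊎x≡y x∈p∪⁅y⁆
... | inj₁ x∈p = x∉p x∈p
... | inj₂ x≡y = x≢y x≡y

p⊆q⇒p-x⊆q-x : p ⊆ q → p - x ⊆ q - x
p⊆q⇒p-x⊆q-x p⊆q y∈p-x = x∈p∧x≢y⇒x∈p-y (p⊆q (p-x⊆p y∈p-x)) λ { refl → x∉p-x y∈p-x }

x∉p⇒p⊂p∪⁅x⁆ : x ∉ p → p ⊂ p ∪ ⁅ x ⁆
x∉p⇒p⊂p∪⁅x⁆ {x = x} x∉p = p⊆p∪q ⁅ x ⁆ , x , x∈p∪q⁺ (inj₂ (x∈⁅x⁆ x)) , x∉p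

module _ (G : Graph n) where

  private variable
    S T U : Subset n
    a b c v : Fin n

  adj-sym : adj G a b ≡ true → adj G b a ≡ true
  adj-sym {a} {b} e = ≡.trans (sym G b a) e

  Conn-source∉ : Conn G S a b → a ∉ S
  Conn-source∉ (here a∉S)     = a∉S
  Conn-source∉ (step a∉S _ _) = a∉S

  Conn-trans : Conn G S a b → Conn G S b c → Conn G S a c
  Conn-trans (here _)       w′ = w′
  Conn-trans (step a∉S e w) w′ = step a∉S e (Conn-trans w w′)

  Conn-sym : Conn G S a b → Conn G S b a
  Conn-sym (here a∉S)     = here a∉S
  Conn-sym (step a∉S e w) =
    Conn-trans (Conn-sym w) (step (Conn-source∉ w) (adj-sym e) (here a∉S))

  Conn-antitone : T ⊆ S → Conn G S a b → Conn G T a b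
  Conn-antitone T⊆S (here a∉S)     = here (λ a∈T → a∉S (T⊆S a∈T))
  Conn-antitone T⊆S (step a∉S e w) = step (λ a∈T → a∉S (T⊆S a∈T)) e (Conn-antitone T⊆S w)

  Conn-minus : Conn G S a b → Conn G (S - v) a b
  Conn-minus = Conn-antitone p-x⊆p

  Conn-avoid : Conn G S a b → b ≢ v →
    Conn G (S ∪ ⁅ v ⁆) a b ⊎ ∃[ c ] (adj G v c ≡ true × Conn G (S ∪ ⁅ v ⁆) c b)
  Conn-avoid (here b∉S) b≢v = inj₁ (here (x∉p∧x≢y⇒x∉p∪⁅y⁆ b∉S b≢v))
  Conn-avoid {a = a} {v = v} (step {y = c} a∉S e w) b≢v with Conn-avoid w b≢v
  ... | inj₂ r = inj₂ r
  ... | inj₁ w′ with a ≟ v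
  ...   | yes refl = inj₂ (c , e , w′)
  ...   | no  a≢v  = inj₁ (step (x∉p∧x≢y⇒x∉p∪⁅y⁆ a∉S a≢v) e w′)

  -- A walk from a need not return to a, so the search goes on in G - (S ∪ ⁅ a ⁆).
  Conn?-acc : ∀ S → Acc _⊃_ S → ∀ a b → Dec (Conn G S a b)
  Conn?-acc S (acc rec) a b with a ∈? S
  ... | yes a∈S = no (λ w → Conn-source∉ w a∈S)
  ... | no  a∉S with a ≟ b
  ...   | yes refl = yes (here a∉S)
  ...   | no  a≢b  = map′ enter leave
          (any? λ c → (adj G a c ≟ᵇ true) ×-dec Conn?-acc (S ∪ ⁅ a ⁆) (rec (x∉p⇒p⊂p∪⁅x⁆ a∉S)) c b)
    where
    enter : ∃[ c ] (adj G a c ≡ true × Conn G (S ∪ ⁅ a ⁆) c b) → Conn G S a b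
    enter (c , e , w) = step a∉S e (Conn-antitone (p⊆p∪q ⁅ a ⁆) w)
    leave : Conn G S a b → ∃[ c ] (adj G a c ≡ true × Conn G (S ∪ ⁅ a ⁆) c b)
    leave w with Conn-avoid w (λ b≡a → a≢b (≡.sym b≡a))
    ... | inj₁ w′ = ⊥-elim (Conn-source∉ w′ (x∈p∪q⁺ (inj₂ (x∈⁅x⁆ a))))
    ... | inj₂ r  = r

  Conn? : ∀ S a b → Dec (Conn G S a b)
  Conn? S = Conn?-acc S (⊃-wellFounded S)

  Conn-through : Conn G (S - v) a b → Conn G S a b ⊎ Conn G (S - v) a v
  Conn-through {v = v} {a = a} (here a∉S-v) with a ≟ v
  ... | yes refl = inj₂ (here a∉S-v)
  ... | no  a≢v  = inj₁ (here λ a∈S → a∉S-v (x∈p∧x≢y⇒x∈p-y a∈S a≢v))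
  Conn-through {v = v} {a = a} (step a∉S-v e w) with a ≟ v
  ... | yes refl = inj₂ (here a∉S-v)
  ... | no  a≢v with Conn-through w
  ...   | inj₁ w′ = inj₁ (step (λ a∈S → a∉S-v (x∈p∧x≢y⇒x∈p-y a∈S a≢v)) e w′)
  ...   | inj₂ w′ = inj₂ (step a∉S-v e w′)

  Conn-isolated : (∀ c → adj G v c ≡ true → c ∈ S) → Conn G (S - v) a b → b ≡ v ⊎ Conn G S a b
  Conn-isolated _ (here a∉S-v) with x∉p-y⇒x∉p⊎x≡y a∉S-v
  ... | inj₁ a∉S = inj₂ (here a∉S)
  ... | inj₂ a≡v = inj₁ a≡v
  Conn-isolated nb (step {y = c} a∉S-v e w) with Conn-isolated nb w
  ... | inj₁ b≡v = inj₁ b≡v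
  ... | inj₂ c∼b with x∉p-y⇒x∉p⊎x≡y a∉S-v
  ...   | inj₁ a∉S = inj₂ (step a∉S e c∼b)
  ...   | inj₂ refl = ⊥-elim (Conn-source∉ c∼b (nb c e))

  Separated : Subset n → ∀ {m} → (Fin m → Fin n) → Set
  Separated S r = (∀ i → r i ∉ S) × (∀ i j → Conn G S (r i) (r j) → i ≡ j)

  Separated-∷ : ∀ {m} {r : Fin m → Fin n} → a ∉ S → (∀ i → ¬ Conn G S a (r i)) →
    Separated S r → Separated S (a VF.∷ r)
  Separated-∷ {a = a} {S = S} {r = r} a∉S apart (r∉S , sep) = out , sep′
    where
    out : ∀ i → (a VF.∷ r) i ∉ S
    out zero    = a∉S
    out (suc i) = r∉S i
    sep′ : ∀ i j → Conn G S ((a VF.∷ r) i) ((a VF.∷ r) j) → i ≡ j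
    sep′ zero    zero    _ = refl
    sep′ zero    (suc j) w = ⊥-elim (apart j w)
    sep′ (suc i) zero    w = ⊥-elim (apart i (Conn-sym w))
    sep′ (suc i) (suc j) w = cong suc (sep i j w)

  Separated⇒≤ : ∀ {m k} {r : Fin m → Fin n} → Separated S r → NumComponents G S k → m ≤ k
  Separated⇒≤ {S = S} {r = r} (r∉S , sep) (ρ , _ , _ , cover) = injective⇒≤ f-injective
    where
    component : ∀ i → ∃[ t ] Conn G S (r i) (ρ t)
    component i = cover (r i) (r∉S i)
    f-injective : ∀ {i j} → proj₁ (component i) ≡ proj₁ (component j) → i ≡ j
    f-injective {i} {j} same = sep i j (Conn-trans (proj₂ (component i))
      (subst (λ t → Conn G S (ρ t) (r j)) (≡.sym same) (Conn-sym (proj₂ (component j)))))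

  Separated-covering : ∀ S (vs : List (Fin n)) → ∃[ k ] Σ (Fin k → Fin n) λ r →
    Separated S r × (∀ a → a ∈ₗ vs → a ∉ S → ∃[ i ] Conn G S a (r i))
  Separated-covering S []       = 0 , (λ ()) , ((λ ()) , (λ ())) , (λ _ ())
  Separated-covering S (a ∷ vs) with Separated-covering S vs
  ... | k , r , separated , covers with a ∈? S
  ...   | yes a∈S = k , r , separated , covers′
    where
    covers′ : ∀ b → b ∈ₗ a ∷ vs → b ∉ S → ∃[ i ] Conn G S b (r i)
    covers′ b (here refl) b∉S = ⊥-elim (b∉S a∈S)
    covers′ b (there b∈vs) b∉S = covers b b∈vs b∉S
  ...   | no a∉S with any? (λ i → Conn? S a (r i))
  ...     | yes a∼r = k , r , separated , covers′
    where
    covers′ : ∀ b → b ∈ₗ a ∷ vs → b ∉ S → ∃[ i ] Conn G S b (r i)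
    covers′ b (here refl) b∉S = a∼r
    covers′ b (there b∈vs) b∉S = covers b b∈vs b∉S
  ...     | no a≁r = suc k , a VF.∷ r , Separated-∷ a∉S (λ i w → a≁r (i , w)) separated , covers′
    where
    covers′ : ∀ b → b ∈ₗ a ∷ vs → b ∉ S → ∃[ i ] Conn G S b ((a VF.∷ r) i)
    covers′ b (here refl) b∉S = zero , here b∉S
    covers′ b (there b∈vs) b∉S with covers b b∈vs b∉S
    ... | i , b∼ri = suc i , b∼ri

  numComponents : ∀ S → ∃[ k ] NumComponents G S k
  numComponents S with Separated-covering S (allFin n)
  ... | k , r , (r∉S , sep) , covers = k , r , r∉S , sep , λ a a∉S → covers a (∈-allFin a) a∉S

  Reconnects₂ : Subset n → Fin n → Fin n → Fin n → Set
  Reconnects₂ S v a b = v ∈ S × a ∉ S × b ∉ S × ¬ Conn G S a b × Conn G (S - v) a b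

  Reconnects₂⇒ReconnectsSome : Reconnects₂ S v a b → ReconnectsSome G S v
  Reconnects₂⇒ReconnectsSome {S = S} {v} {a} {b} (v∈S , a∉S , b∉S , a≁b , a∼b) =
    2 , pair , v∈S , s≤s (s≤s z≤n) , proj₁ separated , proj₂ separated , joined
    where
    pair : Fin 2 → Fin n
    pair = a VF.∷ λ _ → b
    separated : Separated S pair
    separated = Separated-∷ a∉S (λ _ → a≁b) ((λ _ → b∉S) , λ { zero zero _ → refl })
    joined : ∀ i j → Conn G (S - v) (pair i) (pair j)
    joined zero          zero          = here (λ a∈S-v → a∉S (p-x⊆p a∈S-v))
    joined zero          (suc zero)    = a∼b
    joined (suc zero)    zero          = Conn-sym a∼b
    joined (suc zero)    (suc zero)    = here (λ b∈S-v → b∉S (p-x⊆p b∈S-v))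

  ReconnectsSome⇒Reconnects₂ : ReconnectsSome G S v → ∃[ a ] ∃[ b ] Reconnects₂ S v a b
  ReconnectsSome⇒Reconnects₂ (suc zero , _ , _ , s≤s () , _)
  ReconnectsSome⇒Reconnects₂ (suc (suc r) , x , v∈S , _ , x∉S , sep , joined) =
    x zero , x (suc zero) , v∈S , x∉S zero , x∉S (suc zero) ,
    (λ w → zero≢one (sep zero (suc zero) w)) , joined zero (suc zero)
    where
    zero≢one : zero {suc r} ≢ suc zero
    zero≢one ()

  ReconnectsSome? : ∀ S v → Dec (ReconnectsSome G S v)
  ReconnectsSome? S v = map′ (λ (a , b , r) → Reconnects₂⇒ReconnectsSome r) ReconnectsSome⇒Reconnects₂
    (any? λ a → any? λ b → (v ∈? S) ×-dec ¬? (a ∈? S) ×-dec ¬? (b ∈? S) ×-dec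
      ¬? (Conn? S a b) ×-dec Conn? (S - v) a b)

  ¬ReconnectsSome⇒Conn-reflect : ¬ ReconnectsSome G S v → a ∉ S → b ∉ S →
    Conn G (S - v) a b → Conn G S a b
  ¬ReconnectsSome⇒Conn-reflect {S = S} {v} {a} {b} ¬rec a∉S b∉S a∼b with v ∈? S | Conn? S a b
  ... | _       | yes a∼b-in-S = a∼b-in-S
  ... | yes v∈S | no  a≁b      = ⊥-elim (¬rec (Reconnects₂⇒ReconnectsSome (v∈S , a∉S , b∉S , a≁b , a∼b)))
  ... | no  v∉S | no  _        =
    Conn-antitone (λ c∈S → x∈p∧x≢y⇒x∈p-y c∈S λ { refl → v∉S c∈S }) a∼b

  Reconnects₂⇒<c : Reconnects₂ T v a b → _<c_ G (T - v) T
  Reconnects₂⇒<c {T = T} {v} {x₀} {x₁} (_ , x₀∉T , x₁∉T , x₀≁x₁ , x₀∼x₁)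
                 _ _ (r , r∉T-v , sep , _) count =
    Separated⇒≤ (Separated-∷ x₁∉T x₁≁rep (proj₁ ∘ proj₂ ∘ pick , rep-sep)) count
    where
    x₀∼v : Conn G (T - v) x₀ v
    x₀∼v with Conn-through x₀∼x₁
    ... | inj₁ x₀∼x₁-in-T = ⊥-elim (x₀≁x₁ x₀∼x₁-in-T)
    ... | inj₂ x₀∼v′      = x₀∼v′
    -- A vertex outside T in the component of r i, chosen to be x₀ whenever possible,
    -- so that x₁ is separated from all of them.
    pick : ∀ i → ∃[ c ] (c ∉ T × Conn G (T - v) (r i) c × (Conn G (T - v) (r i) x₀ → c ≡ x₀))
    pick i with Conn? (T - v) (r i) x₀
    ... | yes ri∼x₀ = x₀ , x₀∉T , ri∼x₀ , λ _ → refl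
    ... | no  ri≁x₀ with x∉p-y⇒x∉p⊎x≡y (r∉T-v i)
    ...   | inj₁ ri∉T = r i , ri∉T , here (r∉T-v i) , λ ri∼x₀ → ⊥-elim (ri≁x₀ ri∼x₀)
    ...   | inj₂ ri≡v = ⊥-elim (ri≁x₀ (subst (λ c → Conn G (T - v) c x₀) (≡.sym ri≡v) (Conn-sym x₀∼v)))
    rep : Fin _ → Fin n
    rep i = proj₁ (pick i)
    ri∼rep : ∀ i → Conn G (T - v) (r i) (rep i)
    ri∼rep i = proj₁ (proj₂ (proj₂ (pick i)))
    rep-sep : ∀ i j → Conn G T (rep i) (rep j) → i ≡ j
    rep-sep i j w = sep i j (Conn-trans (ri∼rep i) (Conn-trans (Conn-minus w) (Conn-sym (ri∼rep j))))
    x₁≁rep : ∀ i → ¬ Conn G T x₁ (rep i)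
    x₁≁rep i w = x₀≁x₁ (subst (λ c → Conn G T c x₁) rep≡x₀ (Conn-sym w))
      where
      ri∼x₀ : Conn G (T - v) (r i) x₀
      ri∼x₀ = Conn-trans (ri∼rep i) (Conn-trans (Conn-sym (Conn-minus w)) (Conn-sym x₀∼x₁))
      rep≡x₀ : rep i ≡ x₀
      rep≡x₀ = proj₂ (proj₂ (proj₂ (pick i))) ri∼x₀

  CutSet⇒neighbour∉ : CutSet G S → v ∈ S → ∃[ c ] (c ∉ S × adj G v c ≡ true)
  CutSet⇒neighbour∉ (inj₁ refl) v∈∅ = ⊥-elim (∉⊥ v∈∅)
  CutSet⇒neighbour∉ {S = S} {v} (inj₂ cut) v∈S
    with any? (λ c → ¬? (c ∈? S) ×-dec (adj G v c ≟ᵇ true))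
  ... | yes neighbour = neighbour
  ... | no  none with numComponents S | numComponents (S - v)
  ...   | k , count@(r , r∉S , sep , _) | k′ , count′ =
    ⊥-elim (<-asym (cut v v∈S k′ k count′ count) (Separated⇒≤ separated count′))
    where
    nb : ∀ c → adj G v c ≡ true → c ∈ S
    nb c e with c ∈? S
    ... | yes c∈S = c∈S
    ... | no  c∉S = ⊥-elim (none (c , c∉S , e))
    r≢v : ∀ i → r i ≢ v
    r≢v i refl = r∉S i v∈S
    -- With no neighbour outside S, v is isolated in G - (S - v), so c(S - v) ≥ c(S) + 1.
    separated : Separated (S - v) (v VF.∷ r)
    separated = Separated-∷ x∉p-x v≁r ((λ i ri∈S-v → r∉S i (p-x⊆p ri∈S-v)) , r-sep)
      where
      v≁r : ∀ i → ¬ Conn G (S - v) v (r i)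
      v≁r i w with Conn-isolated nb w
      ... | inj₁ ri≡v = r≢v i ri≡v
      ... | inj₂ v∼ri = Conn-source∉ v∼ri v∈S
      r-sep : ∀ i j → Conn G (S - v) (r i) (r j) → i ≡ j
      r-sep i j w with Conn-isolated nb w
      ... | inj₁ rj≡v = ⊥-elim (r≢v j rj≡v)
      ... | inj₂ ri∼rj = sep i j ri∼rj

  ≤c-reflect : T ⊆ U → (∀ {a b} → a ∉ U → b ∉ U → Conn G T a b → Conn G U a b) → _≤c_ G U T
  ≤c-reflect T⊆U reflect _ _ (r , r∉U , sep , _) count =
    Separated⇒≤ ((λ i ri∈T → r∉U i (T⊆U ri∈T)) , λ i j w → sep i j (reflect (r∉U i) (r∉U j) w)) count

  ≤c-reach : T ⊆ U → (∀ a → a ∉ T → ∃[ b ] (b ∉ U × Conn G T a b)) → _≤c_ G T U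
  ≤c-reach {T = T} {U} T⊆U reach _ _ (r , r∉T , sep , _) count =
    Separated⇒≤ ((λ i → proj₁ (proj₂ (reach (r i) (r∉T i)))) , reach-sep) count
    where
    ri∼ : ∀ i → Conn G T (r i) (proj₁ (reach (r i) (r∉T i)))
    ri∼ i = proj₂ (proj₂ (reach (r i) (r∉T i)))
    reach-sep : ∀ i j → Conn G U (proj₁ (reach (r i) (r∉T i))) (proj₁ (reach (r j) (r∉T j))) → i ≡ j
    reach-sep i j w = sep i j (Conn-trans (ri∼ i) (Conn-trans (Conn-antitone T⊆U w) (Conn-sym (ri∼ j))))

  transversal-intro : ∀ {W} → (∀ {w} → w ∈ W → w ∉ S) →
    (∀ {w w′} → w ∈ W → w′ ∈ W → Conn G S w w′ → w ≡ w′) →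
    (∀ a → a ∉ S → ∃[ w ] (w ∈ W × Conn G S a w)) → Transversal G S W
  transversal-intro W∉S sep cover =
    W∉S , λ a a∉S → cover a a∉S , λ _ _ w∈W w′∈W a∼w a∼w′ → sep w∈W w′∈W (Conn-trans (Conn-sym a∼w) a∼w′)

  Transversal-separated : ∀ {W w w′} → Transversal G S W → w ∈ W → w′ ∈ W → Conn G S w w′ → w ≡ w′
  Transversal-separated (W∉S , unique) w∈W w′∈W w∼w′ =
    proj₂ (unique _ (W∉S w∈W)) _ _ w∈W w′∈W (here (W∉S w∈W)) w∼w′

  Transversal-minus : ∀ {W} → ¬ ReconnectsSome G S v → Transversal G S W →
    ∃[ W′ ] (Transversal G (S - v) W′ × W ⊆ W′)
  Transversal-minus {S = S} {v} {W} ¬rec t@(W∉S , unique) =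
    extend (any? λ w → (w ∈? W) ×-dec Conn? (S - v) v w)
    where
    W∉S-v : ∀ {w} → w ∈ W → w ∉ S - v
    W∉S-v w∈W w∈S-v = W∉S w∈W (p-x⊆p w∈S-v)
    W-sep : ∀ {w w′} → w ∈ W → w′ ∈ W → Conn G (S - v) w w′ → w ≡ w′
    W-sep w∈W w′∈W w∼w′ =
      Transversal-separated t w∈W w′∈W (¬ReconnectsSome⇒Conn-reflect ¬rec (W∉S w∈W) (W∉S w′∈W) w∼w′)
    cover : ∀ {W′} → W ⊆ W′ → ∃[ w ] (w ∈ W′ × Conn G (S - v) v w) →
      ∀ a → a ∉ S - v → ∃[ w ] (w ∈ W′ × Conn G (S - v) a w)
    cover W⊆W′ v∼W′ a a∉S-v with x∉p-y⇒x∉p⊎x≡y a∉S-v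
    ... | inj₂ refl = v∼W′
    ... | inj₁ a∉S with proj₁ (unique a a∉S)
    ...   | w , w∈W , a∼w = w , W⊆W′ w∈W , Conn-minus a∼w
    extend : Dec (∃[ w ] (w ∈ W × Conn G (S - v) v w)) → ∃[ W′ ] (Transversal G (S - v) W′ × W ⊆ W′)
    extend (yes v∼W) = W , transversal-intro W∉S-v W-sep (cover (λ w∈W → w∈W) v∼W) , λ w∈W → w∈W
    extend (no  v≁W) =
      W ∪ ⁅ v ⁆ , transversal-intro W∪v∉S-v W∪v-sep (cover (p⊆p∪q ⁅ v ⁆) (v , v∈W∪v , here x∉p-x)) ,
      p⊆p∪q ⁅ v ⁆
      where
      v∈W∪v : v ∈ W ∪ ⁅ v ⁆
      v∈W∪v = x∈p∪q⁺ (inj₂ (x∈⁅x⁆ v))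
      W∪v∉S-v : ∀ {w} → w ∈ W ∪ ⁅ v ⁆ → w ∉ S - v
      W∪v∉S-v w∈ with x∈p∪⁅y⁆⇒x∈p⊎x≡y w∈
      ... | inj₁ w∈W = W∉S-v w∈W
      ... | inj₂ refl = x∉p-x
      W∪v-sep : ∀ {w w′} → w ∈ W ∪ ⁅ v ⁆ → w′ ∈ W ∪ ⁅ v ⁆ → Conn G (S - v) w w′ → w ≡ w′
      W∪v-sep w∈ w′∈ w∼w′ with x∈p∪⁅y⁆⇒x∈p⊎x≡y w∈ | x∈p∪⁅y⁆⇒x∈p⊎x≡y w′∈
      ... | inj₁ w∈W  | inj₁ w′∈W = W-sep w∈W w′∈W w∼w′
      ... | inj₁ w∈W  | inj₂ refl = ⊥-elim (v≁W (_ , w∈W , Conn-sym w∼w′))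
      ... | inj₂ refl | inj₁ w′∈W = ⊥-elim (v≁W (_ , w′∈W , w∼w′))
      ... | inj₂ refl | inj₂ refl = refl

  ≤c-below-CutSet : T ⊆ U → U ⊆ S → CutSet G S → _≤c_ G T U
  ≤c-below-CutSet {T = T} {U} T⊆U U⊆S cut = ≤c-reach T⊆U reach
    where
    reach : ∀ a → a ∉ T → ∃[ b ] (b ∉ U × Conn G T a b)
    reach a a∉T with a ∈? U
    ... | no  a∉U = a , a∉U , here a∉T
    ... | yes a∈U with CutSet⇒neighbour∉ cut (U⊆S a∈U)
    ...   | b , b∉S , e = b , (λ b∈U → b∉S (U⊆S b∈U)) , step a∉T e (here λ b∈T → b∉S (U⊆S (T⊆U b∈T)))

  data Pruned (U : Subset n) : Subset n → Set where
    start : Pruned U U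
    prune : Pruned U S → ¬ ReconnectsSome G S v → Pruned U (S - v)

  Pruned⇒⊆ : Pruned U S → S ⊆ U
  Pruned⇒⊆ start       a∈U   = a∈U
  Pruned⇒⊆ (prune p _) a∈S-v = Pruned⇒⊆ p (p-x⊆p a∈S-v)

  Pruned-Conn-reflect : Pruned U S → a ∉ U → b ∉ U → Conn G S a b → Conn G U a b
  Pruned-Conn-reflect start          _   _   w = w
  Pruned-Conn-reflect (prune p ¬rec) a∉U b∉U w = Pruned-Conn-reflect p a∉U b∉U
    (¬ReconnectsSome⇒Conn-reflect ¬rec (λ a∈S → a∉U (Pruned⇒⊆ p a∈S)) (λ b∈S → b∉U (Pruned⇒⊆ p b∈S)) w)

  Pruned-Reconnects₂ : Pruned U S → v ∈ S → Reconnects₂ U v a b → Reconnects₂ S v a b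
  Pruned-Reconnects₂ p v∈S (_ , a∉U , b∉U , a≁b , a∼b) =
    v∈S , (λ a∈S → a∉U (Pruned⇒⊆ p a∈S)) , (λ b∈S → b∉U (Pruned⇒⊆ p b∈S)) ,
    (λ w → a≁b (Pruned-Conn-reflect p a∉U b∉U w)) , Conn-antitone (p⊆q⇒p-x⊆q-x (Pruned⇒⊆ p)) a∼b

  Pruned⇒¬ReconnectsSome : Pruned U S → v ∈ U → v ∉ S → ¬ ReconnectsSome G U v
  Pruned⇒¬ReconnectsSome start v∈U v∉U = contradiction v∈U v∉U
  Pruned⇒¬ReconnectsSome {v = v} (prune {S = S} {v = u} p ¬rec) v∈U v∉S-u rec with v ∈? S
  ... | no  v∉S = Pruned⇒¬ReconnectsSome p v∈U v∉S rec
  ... | yes v∈S with v ≟ u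
  ...   | no  v≢u  = v∉S-u (x∈p∧x≢y⇒x∈p-y v∈S v≢u)
  ...   | yes refl with ReconnectsSome⇒Reconnects₂ rec
  ...     | _ , _ , r = ¬rec (Reconnects₂⇒ReconnectsSome (Pruned-Reconnects₂ p v∈S r))

  Pruned-PartOfTransversal : ∀ {W} → Pruned U S → PartOfTransversal G U W → PartOfTransversal G S W
  Pruned-PartOfTransversal start          part = part
  Pruned-PartOfTransversal (prune p ¬rec) part with Pruned-PartOfTransversal p part
  ... | W′ , t , W⊆W′ with Transversal-minus ¬rec t
  ...   | W″ , t′ , W′⊆W″ = W″ , t′ , λ w∈W → W′⊆W″ (W⊆W′ w∈W)

  prune-admissible : ∀ us → Pruned U S → Admissible G U S us →
    ∃[ S′ ] (Pruned U S′ × S′ ⊆ S × All (λ u → u ∉ S′) us)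
  prune-admissible []       p _ = _ , p , (λ a∈S → a∈S) , []
  prune-admissible (u ∷ us) p (_ , ¬rec , admissible) with prune-admissible us (prune p ¬rec) admissible
  ... | S′ , p′ , S′⊆S-u , us∉S′ =
    S′ , p′ , (λ a∈S′ → p-x⊆p (S′⊆S-u a∈S′)) , (λ u∈S′ → x∉p-x (S′⊆S-u u∈S′)) ∷ us∉S′

  AllReconnecting : Subset n → Set
  AllReconnecting T = ∀ v → v ∈ T → ReconnectsSome G T v

  prune-fully : Pruned U S → Acc _⊂_ S → ∃[ T ] (Pruned U T × T ⊆ S × AllReconnecting T)
  prune-fully {S = S} p (acc smaller) with any? (λ v → (v ∈? S) ×-dec ¬? (ReconnectsSome? S v))
  ... | yes (v , v∈S , ¬rec) with prune-fully (prune p ¬rec) (smaller (x∈p⇒p-x⊂p v∈S))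
  ...   | T , p′ , T⊆S-v , all = T , p′ , (λ a∈T → p-x⊆p (T⊆S-v a∈T)) , all
  prune-fully {S = S} p _ | no none =
    S , p , (λ a∈S → a∈S) , λ v v∈S → decidable-stable (ReconnectsSome? S v) λ ¬rec → none (v , v∈S , ¬rec)

  AllReconnecting⇒CutSet : AllReconnecting T → CutSet G T
  AllReconnecting⇒CutSet all =
    inj₂ λ v v∈T → Reconnects₂⇒<c (proj₂ (proj₂ (ReconnectsSome⇒Reconnects₂ (all v v∈T))))

  Pruned⇒GoodCutSet : Pruned U T → AllReconnecting T → GoodCutSet G U T
  Pruned⇒GoodCutSet {U = U} {T = T} p all =
    AllReconnecting⇒CutSet all , T⊆U , U≤T , (λ _ → Pruned-PartOfTransversal p) ,
    (λ _ → Pruned⇒¬ReconnectsSome p) ,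
    λ (S , cut , U⊆S) k k′ count count′ →
      ≤-antisym (≤c-below-CutSet T⊆U U⊆S cut k k′ count count′) (U≤T k′ k count′ count)
    where
    T⊆U : T ⊆ U
    T⊆U = Pruned⇒⊆ p
    U≤T : _≤c_ G U T
    U≤T = ≤c-reflect T⊆U (Pruned-Conn-reflect p)

  GoodCutSet-within : Pruned U S → ∃[ T ] (GoodCutSet G U T × T ⊆ S)
  GoodCutSet-within {S = S} p with prune-fully p (⊂-wellFounded S)
  ... | T , p′ , T⊆S , all = T , Pruned⇒GoodCutSet p′ all , T⊆S

lemma3p4 : ∀ {n} (G : Graph n) (U : Subset n) → U ⊂ ⊤ →
    (∃[ T ] GoodCutSet G U T) ×
    (∀ (us : List (Fin n)) → Admissible G U U us →
       ∃[ T ] (GoodCutSet G U T × All (λ u → u ∉ T) us))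
lemma3p4 G U _ = good , avoiding
  where
  good : ∃[ T ] GoodCutSet G U T
  good with GoodCutSet-within G start
  ... | T , T-good , _ = T , T-good
  avoiding : ∀ us → Admissible G U U us → ∃[ T ] (GoodCutSet G U T × All (λ u → u ∉ T) us)
  avoiding us admissible with prune-admissible G us start admissible
  ... | S , p , _ , us∉S with GoodCutSet-within G p
  ...   | T , T-good , T⊆S = T , T-good , All-map (λ u∉S u∈T → u∉S (T⊆S u∈T)) us∉S
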